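{- Let $T$ be a complete binary tree with rotor pointers in an arbitrary state, let $u$ be a node at level $d'$, and fix a level $d$. Execute the operation $\mathrm{flip}(d)$. If $d'\le d$, then the flip-rank of $u$ becomes $2^{d'}-1$ if it was $0$, and otherwise decreases by exactly $1$. If $d'>d$, then the flip-rank of $u$ either increases by $2^{d}-1$ or decreases by $1$.
   Context: $T$ is a complete binary tree with root at level $0$; each non-leaf node has a rotor pointer pointing to one of its two children. The global path $P$ is the root-to-leaf path obtained by starting at the root and following pointers; $P_d$ is its node at level $d$. The operation $\mathrm{flip}(d)$ toggles the pointers of all nodes $P_{d''}$ for $d''<d$. For a node $w$ at level $k$, its flip-rank $\mathrm{frnk}(w)\ge 0$ is the smallest number of consecutive $\mathrm{flip}(k)$ operations after which $w$ lies on $P$. Flip-ranks are computed with respect to the current pointer state (before and after the flip, respectively). -}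

module Defs where

open import Data.Nat using (ℕ; zero; suc; _<_)
open import Data.Bool using (Bool; true; false)
open import Data.Vec using (Vec; []; _∷_)
open import Data.Unit using (⊤)
open import Data.Empty using (⊥)
open import Data.Product using (_×_)
open import Relation.Binary.PropositionalEquality using (_≡_)
open import Relation.Nullary using (¬_)

-- A complete binary tree of height h (leaves at level h) together with the
-- rotor pointer of every non-leaf node: false = points to left child,
-- true = points to right child.
data Rotors : ℕ → Set where
  leaf : Rotors 0
  node : {n : ℕ} → (ptr : Bool) → (left right : Rotors n) → Rotors (suc n)

-- Nodes at level k are addressed by their root-to-node path: Vec Bool k
-- (false = go left, true = go right).
OnPath : {h k : ℕ} → Rotors h → Vec Bool k → Set
OnPath t [] = ⊤
OnPath leaf (b ∷ u) = ⊥
OnPath (node p l r) (false ∷ u) = (p ≡ false) × OnPath l u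
OnPath (node p l r) (true ∷ u) = (p ≡ true) × OnPath r u

flip : {h : ℕ} → ℕ → Rotors h → Rotors h
flip zero t = t
flip (suc d) leaf = leaf
flip (suc d) (node false l r) = node true (flip d l) r
flip (suc d) (node true l r) = node false l (flip d r)

flips : {h : ℕ} → ℕ → ℕ → Rotors h → Rotors h
flips d zero t = t
flips d (suc m) t = flips d m (flip d t)

IsFrnk : {h k : ℕ} → Rotors h → Vec Bool k → ℕ → Set
IsFrnk {k = k} t u m =
  OnPath (flips k m t) u × (∀ j → j < m → ¬ OnPath (flips k j t) u)

-- The flip-rank has a closed form frnk: reading the path to u from the root,
-- a node whose pointer already points towards u contributes bit 0, any other
-- node bit 1, and frnk is the binary number with the root's bit least
-- significant; u is on P exactly when frnk is 0.  Since P follows the path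
-- to u through its leading 0-bits and leaves it after the first 1-bit, a
-- flip(d) with d' ≤ d turns the leading zeros into ones and that first one
-- into zero: it decrements frnk modulo 2^d'.  Taking d = d' shows that frnk
-- counts down to 0 under repeated flip(d'), so it is the flip-rank.  For
-- d < d' the same happens to the lowest d bits only: either a 1-bit occurs
-- among them (the rank drops by one) or they all turn from 0 to 1 (the rank
-- grows by 2^d − 1).
module Submission where

open import Defs
open import Data.Nat using (ℕ; zero; suc; _+_; _∸_; _^_; _*_; _≤_; _<_; s≤s)
open import Data.Nat.Properties
  using (+-suc; +-identityʳ; <-cmp; m^n>0; ≤-refl; <⇒≤; <⇒≱; n∸n≡0; m∸n≡0⇒m≤n)
open import Data.Bool using (Bool; true; false)
open import Data.Vec using (Vec; []; _∷_)
open import Data.Product using (_×_; Σ; _,_)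
open import Data.Sum using (_⊎_; inj₁; inj₂)
open import Data.Empty using (⊥-elim)
open import Data.Unit using (tt)
open import Relation.Binary using (tri<; tri≈; tri>)
open import Relation.Binary.PropositionalEquality
  using (_≡_; refl; sym; trans; cong; subst; module ≡-Reasoning)
open import Relation.Nullary using (¬_)

double : ℕ → ℕ
double zero = zero
double (suc n) = suc (suc (double n))

double-+ : ∀ m n → double (m + n) ≡ double m + double n
double-+ zero n = refl
double-+ (suc m) n = cong (λ x → suc (suc x)) (double-+ m n)

double≡2* : ∀ n → double n ≡ 2 * n
double≡2* zero = refl
double≡2* (suc n) =
  cong suc (trans (cong suc (double≡2* n)) (sym (+-suc n (n + 0))))

suc-double-2^∸1 : ∀ k → suc (double (2 ^ k ∸ 1)) ≡ 2 ^ suc k ∸ 1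
suc-double-2^∸1 k with 2 ^ k | m^n>0 2 k
... | suc c | _ = trans (cong suc (double≡2* c)) (sym (+-suc c (c + 0)))

suc-double-+-2^∸1 : ∀ m k →
  suc (double (m + (2 ^ k ∸ 1))) ≡ double m + (2 ^ suc k ∸ 1)
suc-double-+-2^∸1 m k = begin
  suc (double (m + (2 ^ k ∸ 1)))       ≡⟨ cong suc (double-+ m _) ⟩
  suc (double m + double (2 ^ k ∸ 1))  ≡⟨ sym (+-suc (double m) _) ⟩
  double m + suc (double (2 ^ k ∸ 1))  ≡⟨ cong (double m +_) (suc-double-2^∸1 k) ⟩
  double m + (2 ^ suc k ∸ 1)           ∎
  where open ≡-Reasoning

-- Predecessor modulo 2^k, meant for arguments below 2^k.
predMod : ℕ → ℕ → ℕ
predMod k zero = 2 ^ k ∸ 1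
predMod k (suc m) = m

suc-double-predMod : ∀ k m → suc (double (predMod k m)) ≡ predMod (suc k) (double m)
suc-double-predMod k zero = suc-double-2^∸1 k
suc-double-predMod k (suc m) = refl

least-unique : ∀ {P : ℕ → Set} {m n} →
  P m → (∀ j → j < m → ¬ P j) → P n → (∀ j → j < n → ¬ P j) → m ≡ n
least-unique {m = m} {n} pm m-least pn n-least with <-cmp m n
... | tri< m<n _ _ = ⊥-elim (n-least m m<n pm)
... | tri≈ _ m≡n _ = m≡n
... | tri> _ _ n<m = ⊥-elim (m-least n n<m pn)

frnk : ∀ {h k} → Rotors h → Vec Bool k → ℕ
frnk t [] = 0
frnk leaf (b ∷ u) = 0
frnk (node false l r) (false ∷ u) = double (frnk l u)
frnk (node false l r) (true ∷ u) = suc (double (frnk r u))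
frnk (node true l r) (false ∷ u) = suc (double (frnk l u))
frnk (node true l r) (true ∷ u) = double (frnk r u)

OnPath⇒frnk≡0 : ∀ {h k} (t : Rotors h) (u : Vec Bool k) → OnPath t u → frnk t u ≡ 0
OnPath⇒frnk≡0 t [] _ = refl
OnPath⇒frnk≡0 (node false l r) (false ∷ u) (_ , on) = cong double (OnPath⇒frnk≡0 l u on)
OnPath⇒frnk≡0 (node true l r) (true ∷ u) (_ , on) = cong double (OnPath⇒frnk≡0 r u on)
OnPath⇒frnk≡0 (node false l r) (true ∷ u) (() , _)
OnPath⇒frnk≡0 (node true l r) (false ∷ u) (() , _)

frnk≡0⇒OnPath : ∀ {h k} (t : Rotors h) (u : Vec Bool k) → k ≤ h →
  frnk t u ≡ 0 → OnPath t u
frnk≡0⇒OnPath t [] _ _ = tt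
frnk≡0⇒OnPath (node false l r) (false ∷ u) (s≤s k≤h) _ with frnk l u in eq
... | zero = refl , frnk≡0⇒OnPath l u k≤h eq
frnk≡0⇒OnPath (node true l r) (true ∷ u) (s≤s k≤h) _ with frnk r u in eq
... | zero = refl , frnk≡0⇒OnPath r u k≤h eq

frnk-flip-≤ : ∀ {h k} d (t : Rotors h) (u : Vec Bool k) → k ≤ h → k ≤ d →
  frnk (flip d t) u ≡ predMod k (frnk t u)
frnk-flip-≤ d t [] _ _ = refl
frnk-flip-≤ (suc d) (node false l r) (false ∷ u) (s≤s k≤h) (s≤s k≤d) =
  trans (cong (λ n → suc (double n)) (frnk-flip-≤ d l u k≤h k≤d))
        (suc-double-predMod _ (frnk l u))
frnk-flip-≤ (suc d) (node false l r) (true ∷ u) _ _ = refl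
frnk-flip-≤ (suc d) (node true l r) (false ∷ u) _ _ = refl
frnk-flip-≤ (suc d) (node true l r) (true ∷ u) (s≤s k≤h) (s≤s k≤d) =
  trans (cong (λ n → suc (double n)) (frnk-flip-≤ d r u k≤h k≤d))
        (suc-double-predMod _ (frnk r u))

frnk-flip-> : ∀ {h k} d (t : Rotors h) (u : Vec Bool k) → k ≤ h → d < k →
  frnk (flip d t) u ≡ frnk t u + (2 ^ d ∸ 1) ⊎ suc (frnk (flip d t) u) ≡ frnk t u
frnk-flip-> zero t u _ _ = inj₁ (sym (+-identityʳ _))
frnk-flip-> (suc d) (node false l r) (false ∷ u) (s≤s k≤h) (s≤s d<k)
  with frnk-flip-> d l u k≤h d<k
... | inj₁ eq = inj₁ (trans (cong (λ n → suc (double n)) eq) (suc-double-+-2^∸1 (frnk l u) d))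
... | inj₂ eq = inj₂ (cong double eq)
frnk-flip-> (suc d) (node false l r) (true ∷ u) _ _ = inj₂ refl
frnk-flip-> (suc d) (node true l r) (false ∷ u) _ _ = inj₂ refl
frnk-flip-> (suc d) (node true l r) (true ∷ u) (s≤s k≤h) (s≤s d<k)
  with frnk-flip-> d r u k≤h d<k
... | inj₁ eq = inj₁ (trans (cong (λ n → suc (double n)) eq) (suc-double-+-2^∸1 (frnk r u) d))
... | inj₂ eq = inj₂ (cong double eq)

frnk-flips : ∀ {h k} j (t : Rotors h) (u : Vec Bool k) → k ≤ h → j ≤ frnk t u →
  frnk (flips k j t) u ≡ frnk t u ∸ j
frnk-flips zero t u _ _ = refl
frnk-flips {k = k} (suc j) t u k≤h j<rank
  with frnk t u | frnk-flip-≤ k t u k≤h ≤-refl | j<rank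
... | suc r | eq | s≤s j≤r =
  trans (frnk-flips j (flip k t) u k≤h (subst (j ≤_) (sym eq) j≤r)) (cong (_∸ j) eq)

IsFrnk-frnk : ∀ {h k} (t : Rotors h) (u : Vec Bool k) → k ≤ h → IsFrnk t u (frnk t u)
IsFrnk-frnk {k = k} t u k≤h = reached , not-before
  where
  reached : OnPath (flips k (frnk t u) t) u
  reached = frnk≡0⇒OnPath _ u k≤h
    (trans (frnk-flips (frnk t u) t u k≤h ≤-refl) (n∸n≡0 (frnk t u)))
  not-before : ∀ j → j < frnk t u → ¬ OnPath (flips k j t) u
  not-before j j<rank on = <⇒≱ j<rank (m∸n≡0⇒m≤n
    (trans (sym (frnk-flips j t u k≤h (<⇒≤ j<rank))) (OnPath⇒frnk≡0 _ u on)))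

IsFrnk⇒≡frnk : ∀ {h k} (t : Rotors h) (u : Vec Bool k) {m} → k ≤ h →
  IsFrnk t u m → m ≡ frnk t u
IsFrnk⇒≡frnk t u k≤h (reached , not-before) =
  let (reached′ , not-before′) = IsFrnk-frnk t u k≤h
  in least-unique reached not-before reached′ not-before′

IsFrnk-flip-≤ : ∀ {h k} d (t : Rotors h) (u : Vec Bool k) {m} → k ≤ h → k ≤ d →
  IsFrnk t u m → IsFrnk (flip d t) u (predMod k m)
IsFrnk-flip-≤ d t u k≤h k≤d rank rewrite IsFrnk⇒≡frnk t u k≤h rank =
  subst (IsFrnk (flip d t) u) (frnk-flip-≤ d t u k≤h k≤d) (IsFrnk-frnk (flip d t) u k≤h)

IsFrnk-flip-> : ∀ {h k} d (t : Rotors h) (u : Vec Bool k) {m} → k ≤ h → d < k →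
  IsFrnk t u m →
  IsFrnk (flip d t) u (m + (2 ^ d ∸ 1)) ⊎
  Σ ℕ (λ n → (m ≡ suc n) × IsFrnk (flip d t) u n)
IsFrnk-flip-> d t u k≤h d<k rank rewrite IsFrnk⇒≡frnk t u k≤h rank
  with frnk-flip-> d t u k≤h d<k
... | inj₁ eq = inj₁ (subst (IsFrnk (flip d t) u) eq (IsFrnk-frnk (flip d t) u k≤h))
... | inj₂ eq = inj₂ (_ , sym eq , IsFrnk-frnk (flip d t) u k≤h)

lemma3 : {h d' : ℕ} (t : Rotors h) (u : Vec Bool d') (d : ℕ) →
    d' ≤ h → d ≤ h → (m : ℕ) → IsFrnk t u m →
    (d' ≤ d →
      (m ≡ 0 → IsFrnk (flip d t) u (2 ^ d' ∸ 1)) ×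
      ((n : ℕ) → m ≡ suc n → IsFrnk (flip d t) u n)) ×
    (d < d' →
      IsFrnk (flip d t) u (m + (2 ^ d ∸ 1)) ⊎
      Σ ℕ (λ n → (m ≡ suc n) × IsFrnk (flip d t) u n))
lemma3 t u d d'≤h _ m rank =
  (λ d'≤d → let after = IsFrnk-flip-≤ d t u d'≤h d'≤d rank
            in (λ { refl → after }) , (λ { n refl → after })) ,
  (λ d<d' → IsFrnk-flip-> d t u d'≤h d<d' rank)
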